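{- Let $1\ne w\in\mathbf{F}_k$ be cyclically reduced, and let $L,r\ge1$. For every $\Gamma\in\mathcal{Q}_{w,L,r}$ one has $\chi(\Gamma)=e_\Gamma-v_\Gamma+1\ge1$.
   Context: Write $w=g_{i_1}^{\alpha_1}\cdots g_{i_m}^{\alpha_m}$ (cyclically reduced: reduced and $g_{i_m}^{\alpha_m}\ne g_{i_1}^{ -\alpha_1}$). The universal graph $\widetilde{\Gamma}_{w,L,r}$ is the disjoint union of $r$ directed cycles; the $c$-th has vertices $s^c_0,\dots,s^c_{Lm-1}$ and, for $b=1,\dots,Lm$, an edge of color $i_{b'}$ (where $b'\equiv b \pmod m$, $1\le b'\le m$) from $s^c_{b-1}$ to $s^c_{b\bmod Lm}$ if $\alpha_{b'}=1$, reversed if $\alpha_{b'}=-1$. A quotient of $\widetilde{\Gamma}_{w,L,r}$ by a partition of its vertex set has the blocks as vertices and an edge of a given color between two blocks whenever some edge of that color joins vertices of these blocks (with that orientation); it is realizable if it has no two distinct edges of the same color with a common head and different tails, or a common tail and different heads. $\mathcal{Q}_{w,L,r}$ is the set of realizable quotients in which the $rL$ vertices $s^c_{jm}$ ($1\le c\le r$, $0\le j\le L-1$) lie in pairwise distinct blocks. $v_\Gamma,e_\Gamma$ are numbers of vertices and edges. -}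

module Defs where

open import Data.Nat using (ℕ; NonZero; _*_; _+_)
open import Data.Nat.Properties using (m*n≢0)
open import Data.Nat.DivMod using (_mod_)
open import Data.Fin using (Fin; toℕ)
open import Data.Fin.Properties using () renaming (_≟_ to _≟F_)
open import Data.Bool using (Bool; true; false; not)
open import Data.Product using (Σ; _×_; _,_; proj₁; proj₂)
open import Data.Product.Properties using (≡-dec)
open import Data.List using (List; length; map; deduplicate; cartesianProduct; allFin)
open import Relation.Binary.PropositionalEquality using (_≡_)
open import Relation.Nullary using (¬_)

-- A letter of the free group F_k: a generator g_i (i : Fin k) with an
-- exponent α ∈ {+1, -1}; true encodes +1, false encodes -1.
Letter : ℕ → Set
Letter k = Fin k × Bool

Inverse : ∀ {k} → Letter k → Letter k → Set
Inverse (i , α) (j , β) = (i ≡ j) × (β ≡ not α)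

-- A word w = g_{i_1}^{α_1} ⋯ g_{i_m}^{α_m} is given by its length m and
-- the function b ↦ (i_{b+1}, α_{b+1}) (0-indexed positions b : Fin m).
-- Cyclically reduced: each letter is not inverse to the cyclically next
-- one (this is "reduced" together with g_{i_m}^{α_m} ≠ g_{i_1}^{-α_1}).
CyclicallyReduced : ∀ {k m} .{{_ : NonZero m}} → (Fin m → Letter k) → Set
CyclicallyReduced {m = m} w =
  ∀ (b : Fin m) → ¬ Inverse (w b) (w ((toℕ b + 1) mod m))

module Universal {k m : ℕ} .{{_ : NonZero m}} (w : Fin m → Letter k)
                 (L r : ℕ) .{{_ : NonZero L}} where

  instance
    LmNZ : NonZero (L * m)
    LmNZ = m*n≢0 L m

  Vertex : Set
  Vertex = Fin r × Fin (L * m)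

  -- edges are indexed by (c , q) with q = b - 1 ∈ {0, …, Lm-1}; this edge
  -- joins s^c_q and s^c_{(q+1) mod Lm} and carries the letter with
  -- 0-based index q mod m (i.e. b' - 1 with b' ≡ b mod m).
  UEdge : Set
  UEdge = Fin r × Fin (L * m)

  letterOf : UEdge → Letter k
  letterOf (c , q) = w (toℕ q mod m)

  color : UEdge → Fin k
  color e = proj₁ (letterOf e)

  tail : UEdge → Vertex
  tail (c , q) with proj₂ (letterOf (c , q))
  ... | true  = (c , q)
  ... | false = (c , (toℕ q + 1) mod (L * m))

  head : UEdge → Vertex
  head (c , q) with proj₂ (letterOf (c , q))
  ... | true  = (c , (toℕ q + 1) mod (L * m))
  ... | false = (c , q)

  allUEdges : List UEdge
  allUEdges = cartesianProduct (allFin r) (allFin (L * m))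

  -- A partition of the vertex set into n blocks is a surjection
  -- p : Vertex → Fin n (blocks = nonempty fibres).
  IsPartition : ∀ {n} → (Vertex → Fin n) → Set
  IsPartition {n} p = ∀ (x : Fin n) → Σ Vertex (λ v → p v ≡ x)

  QEdge : ∀ {n} → (Vertex → Fin n) → Fin k → Fin n → Fin n → Set
  QEdge p i x y = Σ UEdge (λ e → (color e ≡ i) × (p (tail e) ≡ x) × (p (head e) ≡ y))

  Realizable : ∀ {n} → (Vertex → Fin n) → Set
  Realizable {n} p = ∀ (i : Fin k) (x y x' y' : Fin n) →
    QEdge p i x y → QEdge p i x' y' → (y ≡ y' → x ≡ x') × (x ≡ x' → y ≡ y')

  dist : Fin r → Fin L → Vertex
  dist c j = (c , (toℕ j * m) mod (L * m))

  SeparatesDistinguished : ∀ {n} → (Vertex → Fin n) → Set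
  SeparatesDistinguished p = ∀ (c c' : Fin r) (j j' : Fin L) →
    p (dist c j) ≡ p (dist c' j') → (c ≡ c') × (j ≡ j')

  -- e_Γ : number of distinct (colour, tail block, head block) triples
  -- arising as images of edges of the universal graph.
  edgeCount : ∀ {n} → (Vertex → Fin n) → ℕ
  edgeCount {n} p = length (deduplicate decT (map img allUEdges))
    where
      img : UEdge → Fin k × Fin n × Fin n
      img e = (color e , p (tail e) , p (head e))
      decT = ≡-dec _≟F_ (≡-dec _≟F_ _≟F_)

module Submission where

-- χ(Γ) = e_Γ - v_Γ + 1 ≥ 1 says e_Γ ≥ v_Γ, and this already holds for every
-- quotient Γ of the universal graph.  The argument is a half-edge count:
--
--  * In any finite graph in which every vertex has two distinct incident
--    half-edges, the vertices are at most as many as the edges, because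
--    vertex × {0,1} injects into edge × {tail,head}  (vertices≤edges).
--  * In the universal graph each vertex s^c_q has an incoming half-edge (the
--    end of the edge from s^c_{q-1}) and an outgoing one (the start of the
--    edge to s^c_{q+1}).  Their images in Γ coincide only if these two
--    consecutive letters of w are mutually inverse, which cyclic reduction
--    forbids.  Hence every block of Γ has two distinct half-edges.

open import Defs
open import Data.Nat using (ℕ; NonZero; _≤_; _<_; _∸_; _*_)
open import Data.Fin using (Fin; toℕ)
open import Data.Integer using (+_; _-_; _+_; _≥_; +≤+)

import Data.Nat as ℕ
open import Data.Nat.Properties using (+-assoc; +-comm; m≤n+m; *-cancelʳ-≤)
open import Data.Nat.DivMod
  using (_%_; _mod_; %-distribˡ-+; m%n%n≡m%n; [m+n]%n≡m%n; m<n⇒m%n≡m; m∣n⇒o%n%m≡o%m)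
open import Data.Nat.Divisibility using (_∣_; n∣m*n)
import Data.Integer.Properties as ℤ
open import Data.Fin.Properties
  using (toℕ-injective; toℕ-fromℕ<; toℕ<n; injective⇒≤; 2↔Bool; *↔×)
  renaming (_≟_ to _≟F_)
open import Data.Bool using (Bool; true; false; not; if_then_else_)
open import Data.Bool.Properties using (not-involutive)
open import Data.Product using (_×_; _,_; proj₁; proj₂; uncurry; map₁)
open import Data.Product.Properties using (≡-dec)
open import Data.Product.Function.NonDependent.Propositional using (_×-↔_)
open import Data.List using (List; length; lookup; map; deduplicate)
open import Data.List.Membership.Propositional using (_∈_)
open import Data.List.Membership.Propositional.Properties
  using (∈-cartesianProduct⁺; ∈-map⁺; ∈-deduplicate⁺; ∈-allFin)
open import Data.List.Relation.Unary.Any using (index)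
open import Data.List.Relation.Unary.Any.Properties using (lookup-index)
open import Function using (_↣_; _↔_; Injective; Injection; mk↣)
open import Function.Construct.Composition using (_↣-∘_; _↔-∘_)
open import Function.Properties.Inverse using (↔-refl; ↔-sym; ↔⇒↣)
open import Relation.Binary.PropositionalEquality
open import Relation.Nullary using (contradiction)

doubled-↣⇒≤ : ∀ {n e} → (Fin n × Bool) ↣ (Fin e × Bool) → n ≤ e
doubled-↣⇒≤ {n} {e} f = *-cancelʳ-≤ n e 2 (injective⇒≤ (Injection.injective g))
  where
  doubled : ∀ {d} → Fin (d * 2) ↔ (Fin d × Bool)
  doubled = (↔-refl ×-↔ 2↔Bool) ↔-∘ *↔×
  g : Fin (n * 2) ↣ Fin (e * 2)
  g = ↔⇒↣ (↔-sym doubled) ↣-∘ (f ↣-∘ ↔⇒↣ doubled)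

index-injective : ∀ {A : Set} {xs : List A} {x y : A} (p : x ∈ xs) (q : y ∈ xs) →
                  index p ≡ index q → x ≡ y
index-injective {xs = xs} p q eq =
  trans (lookup-index p) (trans (cong (lookup xs) eq) (sym (lookup-index q)))

-- A choice of two distinct half-edges at
-- every vertex determines the vertex and the choice, so it is injective.
module HalfEdges {T : Set} {n : ℕ} (D : List T) (end : T → Bool → Fin n)
                 (half : Fin n → Bool → T × Bool)
                 (half-end : ∀ x s → uncurry end (half x s) ≡ x)
                 (half-distinct : ∀ x → half x false ≢ half x true) where

  half-injective : Injective _≡_ _≡_ (uncurry half)
  half-injective {x , s} {x' , s'} eq = sides same-vertex s s' eq
    where
    same-vertex : x ≡ x'
    same-vertex = trans (sym (half-end x s)) (trans (cong (uncurry end) eq) (half-end x' s'))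

    sides : x ≡ x' → ∀ s s' → half x s ≡ half x' s' → (x , s) ≡ (x' , s')
    sides refl false false _  = refl
    sides refl true  true  _  = refl
    sides refl false true  eq = contradiction eq (half-distinct x)
    sides refl true  false eq = contradiction (sym eq) (half-distinct x)

  vertices≤edges : (∀ x s → proj₁ (half x s) ∈ D) → n ≤ length D
  vertices≤edges half∈D = doubled-↣⇒≤ (mk↣ injective)
    where
    code : Fin n × Bool → Fin (length D) × Bool
    code (x , s) = index (half∈D x s) , proj₂ (half x s)
    injective : Injective _≡_ _≡_ code
    injective {x , s} {x' , s'} eq = half-injective (cong₂ _,_ same-edge (cong proj₂ eq))
      where
      same-edge : proj₁ (half x s) ≡ proj₁ (half x' s')
      same-edge = index-injective (half∈D x s) (half∈D x' s') (cong proj₁ eq)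

%-suc : ∀ x d .{{_ : NonZero d}} → (x % d ℕ.+ 1) % d ≡ (x ℕ.+ 1) % d
%-suc x d = begin
  (x % d ℕ.+ 1) % d          ≡⟨ %-distribˡ-+ (x % d) 1 d ⟩
  (x % d % d ℕ.+ 1 % d) % d  ≡⟨ cong (λ y → (y ℕ.+ 1 % d) % d) (m%n%n≡m%n x d) ⟩
  (x % d ℕ.+ 1 % d) % d      ≡⟨ sym (%-distribˡ-+ x 1 d) ⟩
  (x ℕ.+ 1) % d              ∎
  where open ≡-Reasoning

%-pred-suc : ∀ q N .{{_ : NonZero N}} → q < N → ((q ℕ.+ (N ∸ 1)) % N ℕ.+ 1) % N ≡ q
%-pred-suc q N@(ℕ.suc N-1) q<N = begin
  ((q ℕ.+ N-1) % N ℕ.+ 1) % N  ≡⟨ %-suc (q ℕ.+ N-1) N ⟩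
  (q ℕ.+ N-1 ℕ.+ 1) % N        ≡⟨ cong (_% N) (trans (+-assoc q N-1 1) (cong (q ℕ.+_) (+-comm N-1 1))) ⟩
  (q ℕ.+ N) % N                ≡⟨ [m+n]%n≡m%n q N ⟩
  q % N                        ≡⟨ m<n⇒m%n≡m q<N ⟩
  q                            ∎
  where open ≡-Reasoning

sucMod : ∀ {N} .{{_ : NonZero N}} → Fin N → Fin N
sucMod {N} q = (toℕ q ℕ.+ 1) mod N

predMod : ∀ {N} .{{_ : NonZero N}} → Fin N → Fin N
predMod {N} q = (toℕ q ℕ.+ (N ∸ 1)) mod N

sucMod-predMod : ∀ {N} .{{_ : NonZero N}} (q : Fin N) → sucMod (predMod q) ≡ q
sucMod-predMod {N} q = toℕ-injective (begin
  toℕ (sucMod (predMod q))                   ≡⟨ toℕ-fromℕ< _ ⟩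
  (toℕ (predMod q) ℕ.+ 1) % N                ≡⟨ cong (λ y → (y ℕ.+ 1) % N) (toℕ-fromℕ< _) ⟩
  ((toℕ q ℕ.+ (N ∸ 1)) % N ℕ.+ 1) % N        ≡⟨ %-pred-suc (toℕ q) N (toℕ<n q) ⟩
  toℕ q                                      ∎)
  where open ≡-Reasoning

reduce : ∀ {N} d .{{_ : NonZero d}} → Fin N → Fin d
reduce d q = toℕ q mod d

reduce-sucMod : ∀ {N} d .{{_ : NonZero d}} .{{_ : NonZero N}} → d ∣ N →
                (q : Fin N) → reduce d (sucMod q) ≡ sucMod (reduce d q)
reduce-sucMod {N} d d∣N q = toℕ-injective (begin
  toℕ (reduce d (sucMod q))        ≡⟨ toℕ-fromℕ< _ ⟩
  toℕ (sucMod q) % d               ≡⟨ cong (_% d) (toℕ-fromℕ< _) ⟩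
  (toℕ q ℕ.+ 1) % N % d            ≡⟨ m∣n⇒o%n%m≡o%m d N (toℕ q ℕ.+ 1) d∣N ⟩
  (toℕ q ℕ.+ 1) % d                ≡⟨ sym (%-suc (toℕ q) d) ⟩
  (toℕ q % d ℕ.+ 1) % d            ≡⟨ cong (λ y → (y ℕ.+ 1) % d) (sym (toℕ-fromℕ< _)) ⟩
  (toℕ (reduce d q) ℕ.+ 1) % d     ≡⟨ sym (toℕ-fromℕ< _) ⟩
  toℕ (sucMod (reduce d q))        ∎)
  where open ≡-Reasoning

module UniversalGraph {k m : ℕ} .{{_ : NonZero m}} (w : Fin m → Letter k)
                      (L r : ℕ) .{{_ : NonZero L}} where
  open Universal w L r

  sign : UEdge → Bool
  sign e = proj₂ (letterOf e)

  endAt : UEdge → Bool → Vertex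
  endAt e s = if s then head e else tail e

  endAt-sign : ∀ c q → endAt (c , q) (sign (c , q)) ≡ (c , sucMod q)
  endAt-sign c q with sign (c , q)
  ... | true  = refl
  ... | false = refl

  endAt-not-sign : ∀ c q → endAt (c , q) (not (sign (c , q))) ≡ (c , q)
  endAt-not-sign c q with sign (c , q)
  ... | true  = refl
  ... | false = refl

  -- The two half-edges at s^c_q: (true) the end of the edge coming from
  -- s^c_{q-1}, and (false) the start of the edge going to s^c_{q+1}.
  incident : Vertex → Bool → UEdge × Bool
  incident (c , q) true  = (c , predMod q) , sign (c , predMod q)
  incident (c , q) false = (c , q) , not (sign (c , q))

  incident-end : ∀ v s → uncurry endAt (incident v s) ≡ v
  incident-end (c , q) true  = trans (endAt-sign c (predMod q)) (cong (c ,_) (sucMod-predMod q))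
  incident-end (c , q) false = endAt-not-sign c q

  -- The letter read on the edge before s^c_q is the cyclic predecessor (in w)
  -- of the letter read on the edge after it.
  letter-before : ∀ (q : Fin (L * m)) → sucMod (reduce m (predMod q)) ≡ reduce m q
  letter-before q = trans (sym (reduce-sucMod m (n∣m*n L) (predMod q)))
                          (cong (reduce m) (sucMod-predMod q))

  inverse-letters : ∀ {l l' : Letter k} → proj₁ l ≡ proj₁ l' → not (proj₂ l') ≡ proj₂ l →
                    Inverse l l'
  inverse-letters {_ , _} {_ , β} same-generator refl = same-generator , sym (not-involutive β)

  -- No folding at a vertex: for cyclically reduced w the two half-edges at a
  -- vertex never carry the same colour and the same side, since otherwise the
  -- two consecutive letters around it would cancel.
  incident-unfolded : CyclicallyReduced w → ∀ v →
    color (proj₁ (incident v false)) ≡ color (proj₁ (incident v true)) →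
    proj₂ (incident v false) ≢ proj₂ (incident v true)
  incident-unfolded cr (c , q) same-colour same-side =
    cr b (subst (Inverse (w b)) (cong w (sym (letter-before q)))
                (inverse-letters (sym same-colour) same-side))
    where b = reduce m (predMod q)

module Quotient {k m : ℕ} .{{_ : NonZero m}} (w : Fin m → Letter k)
                (cr : CyclicallyReduced w) (L r : ℕ) .{{_ : NonZero L}}
                {n : ℕ} (p : Universal.Vertex w L r → Fin n)
                (part : Universal.IsPartition w L r p) where
  open Universal w L r
  open UniversalGraph w L r

  Triple : Set
  Triple = Fin k × Fin n × Fin n

  image : UEdge → Triple
  image e = color e , p (tail e) , p (head e)

  edges : List Triple
  edges = deduplicate (≡-dec _≟F_ (≡-dec _≟F_ _≟F_)) (map image allUEdges)

  image∈edges : ∀ e → image e ∈ edges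
  image∈edges (c , q) = ∈-deduplicate⁺ {A = Triple} _
    (∈-map⁺ image (∈-cartesianProduct⁺ (∈-allFin c) (∈-allFin q)))

  blockAt : Triple → Bool → Fin n
  blockAt (_ , x , y) s = if s then y else x

  blockAt-image : ∀ e s → blockAt (image e) s ≡ p (endAt e s)
  blockAt-image e true  = refl
  blockAt-image e false = refl

  half : Fin n → Bool → Triple × Bool
  half x s = map₁ image (incident (proj₁ (part x)) s)

  half-end : ∀ x s → uncurry blockAt (half x s) ≡ x
  half-end x s = begin
    uncurry blockAt (half x s)       ≡⟨ uncurry blockAt-image (incident v s) ⟩
    p (uncurry endAt (incident v s)) ≡⟨ cong p (incident-end v s) ⟩
    p v                              ≡⟨ proj₂ (part x) ⟩
    x                                ∎
    where
    open ≡-Reasoning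
    v = proj₁ (part x)

  -- the two half-edges of a block differ, because the universal ones do not fold
  half-distinct : ∀ x → half x false ≢ half x true
  half-distinct x eq = incident-unfolded cr (proj₁ (part x))
    (cong (λ h → proj₁ (proj₁ h)) eq) (cong proj₂ eq)

  blocks≤edges : n ≤ edgeCount p
  blocks≤edges = HalfEdges.vertices≤edges edges blockAt half half-end half-distinct
                   (λ x s → image∈edges (proj₁ (incident (proj₁ (part x)) s)))

euler≥1 : ∀ {e v} → v ≤ e → (+ e) - (+ v) + (+ 1) ≥ + 1
euler≥1 {e} {v} v≤e rewrite ℤ.m-n≡m⊖n e v | ℤ.⊖-≥ v≤e = +≤+ (m≤n+m 1 (e ∸ v))

lemma13 : ∀ {k m : ℕ} .{{_ : NonZero m}} (w : Fin m → Letter k) →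
          CyclicallyReduced w →
          ∀ (L r : ℕ) .{{_ : NonZero L}} .{{_ : NonZero r}} →
          ∀ (n : ℕ) (p : Universal.Vertex w L r → Fin n) →
          Universal.IsPartition w L r p →
          Universal.Realizable w L r p →
          Universal.SeparatesDistinguished w L r p →
          (+ Universal.edgeCount w L r p) - (+ n) + (+ 1) ≥ + 1
lemma13 w cr L r n p part _ _ = euler≥1 (Quotient.blocks≤edges w cr L r p part)
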